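{- Let $T$ be a framed tableau and $k$ an integer. If adding $k$ to (or subtracting $k$ from) every entry of $T$ leaves all entries positive, then the resulting tableau $T\pm k$ is a framed tableau.
   Context: For a partition $\mu=(\mu_1\ge\dots\ge\mu_r)$, $D_\mu=\{(i,j):1\le i\le r,1\le j\le\mu_i\}$ (row $i$ from the bottom); a tableau is $T:D_\mu\to\mathbb{Z}_{>0}$, $t_{i,j}=T(i,j)$, $t_{i,j}=\infty$ off $D_\mu$. $\mathrm{Bcomp}(c,m)$ is the unique weakly increasing integer sequence of length $m$ with sum $c$ and max minus min at most $1$. $(\mu,s)$, $s=(s_1,\dots,s_r)$, satisfies the framing condition if $s_i\ge(2i-1)\mu_i$ for all $i$ and $s_{i+1}\ge s_i+2\mu_i$ whenever $\mu_{i+1}=\mu_i$. $\mathrm{Fram}(\mu,s)$ (with $\mu_{r+1}=0$): row $r$ is $\mathrm{Bcomp}(s_r,\mu_r)$; for $i=r-1$ down to $1$: $a=s_i$, $b=\mu_i$; for $k'=r,\dots,i$: $(r_{i,\mu_{k'+1}+1},\dots,r_{i,\mu_i})=\mathrm{Bcomp}(a,b)$; if $r_{i,j}\le t_{i+1,j}-2$ for all $\mu_{k'+1}<j\le\mu_{k'}$ set $t_{i,j}=r_{i,j}$ for these $j$, else $t_{i,j}=t_{i+1,j}-2$ for these $j$; then $a:=a-\sum_{\mu_{k'+1}<j\le\mu_{k'}}t_{i,j}$, $b:=b-(\mu_{k'}-\mu_{k'+1})$. A framed tableau is $\mathrm{Fram}(\mu,s)$ for some $(\mu,s)$ satisfying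 the framing condition. -}

module Defs where

open import Data.Nat as ℕ using (ℕ; zero; suc; _∸_)
open import Data.Integer as ℤ using (ℤ; +_; _+_; _-_; _*_; _≤_; _<_)
open import Data.Integer.DivMod using (_/ℕ_; _%ℕ_)
open import Data.Bool using (Bool; true; false; if_then_else_; _∧_; _∨_; not)
open import Data.List using (List; []; _∷_; length; upTo; map; foldr)
open import Data.Product using (Σ; _×_; _,_)
open import Relation.Binary.PropositionalEquality using (_≡_)

-- 1-indexed lookup with default value (used for μ_i, with μ_{r+1} = 0, and s_i)
at : {A : Set} → A → List A → ℕ → A
at d []       _             = d
at d (x ∷ xs) zero          = d
at d (x ∷ xs) (suc zero)    = x
at d (x ∷ xs) (suc (suc n)) = at d xs (suc n)

part : List ℕ → ℕ → ℕ
part = at 0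

sv : List ℤ → ℕ → ℤ
sv = at (+ 0)

IsPartition : List ℕ → Set
IsPartition μ =
  ((i : ℕ) → 1 ℕ.≤ i → i ℕ.≤ length μ → 1 ℕ.≤ part μ i) ×
  ((i : ℕ) → 1 ℕ.≤ i → i ℕ.< length μ → part μ (suc i) ℕ.≤ part μ i)

InD : List ℕ → ℕ → ℕ → Set
InD μ i j = (1 ℕ.≤ i) × (i ℕ.≤ length μ) × (1 ℕ.≤ j) × (j ℕ.≤ part μ i)

-- a tableau (of shape μ) is an assignment of integers to cells (i, j)
-- (row i from the bottom, column j), whose entries on D_μ are positive;
-- values outside D_μ are irrelevant.
Tab : Set
Tab = ℕ → ℕ → ℤ

IsTableau : List ℕ → Tab → Set
IsTableau μ T = (i j : ℕ) → InD μ i j → + 0 < T i j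

-- Bcomp(c, m): the unique weakly increasing integer sequence of length m,
-- sum c, max - min ≤ 1.  Explicitly: with q = ⌊c/m⌋ and ρ = c mod m,
-- the first m - ρ entries are q and the last ρ entries are q + 1.
-- bcomp c m p is the p-th entry (1 ≤ p ≤ m).
bcomp : ℤ → ℕ → ℕ → ℤ
bcomp c zero    p = + 0
bcomp c (suc m) p =
  if (suc m ∸ (c %ℕ suc m)) ℕ.<ᵇ p then (c /ℕ suc m) + + 1 else c /ℕ suc m

-- integers lo+1, …, hi
range : ℕ → ℕ → List ℕ
range lo hi = map (λ x → suc (lo ℕ.+ x)) (upTo (hi ∸ lo))


allᵇ : {A : Set} → (A → Bool) → List A → Bool
allᵇ p = foldr (λ x b → p x ∧ b) true

sumℤ : List ℤ → ℤ
sumℤ = foldr _+_ (+ 0)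

-- the list r, r-1, …, i
downTo : ℕ → ℕ → List ℕ
downTo r i = map (λ x → r ∸ x) (upTo (suc (r ∸ i)))

-- One pass of the inner loop of Fram for a fixed row i:
--   prev  : the row i+1 (t_{i+1,j}, valid for j ≤ μnext = μ_{i+1}; ∞ beyond)
--   a, b  : the running quantities of the algorithm
--   ks    : the remaining values of k' (r, r-1, …, i)
--   row   : the entries t_{i,j} assigned so far
processBlocks : List ℕ → (ℕ → ℤ) → ℕ → ℤ → ℕ → List ℕ → (ℕ → ℤ) → (ℕ → ℤ)
processBlocks μ prev μnext a b []        row = row
processBlocks μ prev μnext a b (k ∷ ks) row =
  processBlocks μ prev μnext a′ b′ ks row′
  where
    lo hi : ℕ
    lo = part μ (suc k)
    hi = part μ k
    -- (r_{i,lo+1}, …, r_{i,μ_i}) = Bcomp(a, b)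
    rr : ℕ → ℤ
    rr j = bcomp a b (j ∸ lo)
    -- t_{i+1,j} = ∞ exactly when j > μ_{i+1}
    okAt : ℕ → Bool
    okAt j = not (j ℕ.≤ᵇ μnext) ∨ (rr j ℤ.≤ᵇ (prev j - + 2))
    cond : Bool
    cond = allᵇ okAt (range lo hi)
    new : ℕ → ℤ
    new j = if cond then rr j else prev j - + 2
    a′ : ℤ
    a′ = a - sumℤ (map new (range lo hi))
    b′ : ℕ
    b′ = b ∸ (hi ∸ lo)
    row′ : ℕ → ℤ
    row′ j = if (lo ℕ.<ᵇ j) ∧ (j ℕ.≤ᵇ hi) then new j else row j

-- framRow μ s d is row r - d of Fram(μ, s)
framRow : List ℕ → List ℤ → ℕ → (ℕ → ℤ)
framRow μ s zero    j = bcomp (sv s (length μ)) (part μ (length μ)) j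
framRow μ s (suc d) =
  processBlocks μ (framRow μ s d) (part μ (suc i)) (sv s i) (part μ i)
                (downTo (length μ) i) (λ _ → + 0)
  where
    i : ℕ
    i = length μ ∸ suc d

Fram : List ℕ → List ℤ → Tab
Fram μ s i j = framRow μ s (length μ ∸ i) j

FramingCondition : List ℕ → List ℤ → Set
FramingCondition μ s =
  ((i : ℕ) → 1 ℕ.≤ i → i ℕ.≤ length μ →
     + ((2 ℕ.* i ∸ 1) ℕ.* part μ i) ≤ sv s i) ×
  ((i : ℕ) → 1 ℕ.≤ i → i ℕ.< length μ → part μ (suc i) ≡ part μ i →
     sv s i + + (2 ℕ.* part μ i) ≤ sv s (suc i))

IsFramedTableau : List ℕ → Tab → Set
IsFramedTableau μ T =
  IsPartition μ × IsTableau μ T ×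
  Σ (List ℤ) (λ s → (length s ≡ length μ) × FramingCondition μ s ×
     ((i j : ℕ) → InD μ i j → T i j ≡ Fram μ s i j))

shift : Tab → ℤ → Tab
shift T k i j = T i j + k

module Submission where

-- Translating a framed tableau.  If T = Fram(μ, s) is framed and T + k is still positive,
-- then T + k = Fram(μ, s′) for the sums s′_i = s_i + k·μ_i, and (μ, s′) is framed.
--
-- Every step of the algorithm Fram commutes with translation: Bcomp(c + k·m, m) =
-- Bcomp(c, m) + k (floor division by m), the test r_{i,j} ≤ t_{i+1,j} − 2 is unchanged when
-- both sides move by k, and the running sum keeps the form a + k·b since no block is longer
-- than the remaining length b.  Downward induction on the rows gives Fram(μ, s′) =
-- Fram(μ, s) + k.  The framing condition for s′: its second half is invariant because both
-- sums move by k·μ_i when μ_{i+1} = μ_i; for the first half, the columns of Fram grow by at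
-- least 2 per row, so row i of T + k has entries ≥ 2i − 1, while the first block of row i
-- (proposal Bcomp(s_i, μ_i)) contains an entry at most s_i/μ_i.

open import Algebra.Properties.AbelianGroup using (∙-cancelʳ)
open import Data.Bool using (Bool; T; true; false; if_then_else_; _∧_; _∨_; not)
open import Data.Bool.Properties using (T-≡)
open import Data.Empty using (⊥-elim)
open import Data.Integer as ℤ using (ℤ; +_; _+_; _-_; _*_; -_; _≤_; _<_) renaming (suc to sucℤ)
open import Data.Integer.DivMod
  using (_/ℕ_; _%ℕ_; n%ℕd<d; a≡a%ℕn+[a/ℕn]*n; [n/ℕd]*d≤n; n<s[n/ℕd]*d)
open import Data.Integer.Properties
open import Data.Integer.Tactic.RingSolver using (solve-∀)
open import Data.List using (List; []; _∷_; map; length; upTo; applyUpTo; zipWith)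
import Data.List.Properties as List
open import Data.List.Membership.Propositional using (_∈_)
open import Data.List.Membership.Propositional.Properties using (∈-map⁺; ∈-map⁻; ∈-upTo⁺; ∈-upTo⁻)
open import Data.List.Relation.Unary.All using (All; []; _∷_)
open import Data.List.Relation.Unary.Any as Any using (Any; here; there)
open import Data.Nat as ℕ using (ℕ; zero; suc; _∸_; z≤n; s≤s)
import Data.Nat.Properties as ℕP
open import Data.Product using (_×_; _,_; ∃; proj₁; proj₂)
open import Data.Sum as Sum using (_⊎_; inj₁; inj₂)
open import Data.Unit using (⊤; tt)
open import Function using (Equivalence; _∘_)
open import Relation.Binary.PropositionalEquality
open import Relation.Nullary using (¬_; Dec; yes; no; _×-dec_)
open import Defs

<-suc⇒≤ : ∀ {x y} → x < sucℤ y → x ≤ y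
<-suc⇒≤ {x} {y} x<y+1 = subst (x ≤_) (pred-suc y) (i<j⇒i≤pred[j] x<y+1)

/ℕ-unique : ∀ c d q .{{_ : ℕ.NonZero d}} →
  q * + d ≤ c → c < sucℤ q * + d → c /ℕ d ≡ q
/ℕ-unique c d q lower upper = ≤-antisym
  (<-suc⇒≤ (*-cancelʳ-<-nonNeg (+ d) (≤-<-trans ([n/ℕd]*d≤n c d) upper)))
  (<-suc⇒≤ (*-cancelʳ-<-nonNeg (+ d) (≤-<-trans lower (n<s[n/ℕd]*d c d))))

module _ (c k : ℤ) (m : ℕ) where
  private
    d q : ℤ
    d = + suc m
    q = c /ℕ suc m

  /ℕ-shift : (c + k * d) /ℕ suc m ≡ q + k
  /ℕ-shift = /ℕ-unique (c + k * d) (suc m) (q + k) lower upper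
    where
    lower : (q + k) * d ≤ c + k * d
    lower = subst (_≤ c + k * d) (sym (*-distribʳ-+ d q k))
              (+-monoˡ-≤ (k * d) ([n/ℕd]*d≤n c (suc m)))
    regroup : ∀ q k d → (+ 1 + q) * d + k * d ≡ (+ 1 + (q + k)) * d
    regroup = solve-∀
    upper : c + k * d < sucℤ (q + k) * d
    upper = subst (c + k * d <_) (regroup q k d)
              (+-monoˡ-< (k * d) (n<s[n/ℕd]*d c (suc m)))

  %ℕ-shift : (c + k * d) %ℕ suc m ≡ c %ℕ suc m
  %ℕ-shift = +-injective (∙-cancelʳ +-0-abelianGroup ((q + k) * d) _ _ (begin
      + ((c + k * d) %ℕ suc m) + (q + k) * d
        ≡⟨ cong (λ x → + ((c + k * d) %ℕ suc m) + x * d) (sym /ℕ-shift) ⟩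
      + ((c + k * d) %ℕ suc m) + ((c + k * d) /ℕ suc m) * d
        ≡⟨ sym (a≡a%ℕn+[a/ℕn]*n (c + k * d) (suc m)) ⟩
      c + k * d
        ≡⟨ cong (_+ k * d) (a≡a%ℕn+[a/ℕn]*n c (suc m)) ⟩
      + (c %ℕ suc m) + q * d + k * d
        ≡⟨ +-assoc (+ (c %ℕ suc m)) (q * d) (k * d) ⟩
      + (c %ℕ suc m) + (q * d + k * d)
        ≡⟨ cong (λ x → + (c %ℕ suc m) + x) (sym (*-distribʳ-+ d q k)) ⟩
      + (c %ℕ suc m) + (q + k) * d ∎))
    where open ≡-Reasoning

bcomp-shift : ∀ c k m → 1 ℕ.≤ m → ∀ p → bcomp (c + k * + m) m p ≡ bcomp c m p + k
bcomp-shift c k (suc m) _ p rewrite /ℕ-shift c k m | %ℕ-shift c k m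
  with suc m ∸ c %ℕ suc m ℕ.<ᵇ p
... | true  = swap (c /ℕ suc m) k
  where
  swap : ∀ q k → q + k + + 1 ≡ q + + 1 + k
  swap = solve-∀
... | false = refl

-- The first entry of Bcomp(c, m) is ⌊c/m⌋: only the last (c mod m) < m entries are rounded up.
bcomp-first : ∀ c m → bcomp c (suc m) 1 ≡ c /ℕ suc m
bcomp-first c m with suc m ∸ c %ℕ suc m | ℕP.m<n⇒0<n∸m (n%ℕd<d c (suc m))
... | suc _ | _ = refl

bcomp-≤ : ∀ c m p → bcomp c (suc m) p ≤ c /ℕ suc m + + 1
bcomp-≤ c m p with suc m ∸ c %ℕ suc m ℕ.<ᵇ p
... | true  = ≤-refl
... | false = i≤i+j (c /ℕ suc m) (+ 1)

≤-quotient⇒*≤ : ∀ c m x → x ≤ c /ℕ suc m → + suc m * x ≤ c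
≤-quotient⇒*≤ c m x x≤q = ≤-trans (*-monoˡ-≤-nonNeg (+ suc m) x≤q)
  (subst (_≤ c) (*-comm (c /ℕ suc m) (+ suc m)) ([n/ℕd]*d≤n c (suc m)))

bcomp-first-bound : ∀ c m → 1 ℕ.≤ m → + m * bcomp c m 1 ≤ c
bcomp-first-bound c (suc m) _ = ≤-quotient⇒*≤ c m _ (≤-reflexive (bcomp-first c m))

∈-range⁻ : ∀ {lo hi j} → j ∈ range lo hi → lo ℕ.< j × j ℕ.≤ hi
∈-range⁻ {lo} {hi} j∈range with x , x∈upTo , refl ← ∈-map⁻ (λ x → suc (lo ℕ.+ x)) j∈range =
  s≤s (ℕP.m≤m+n lo x) , (begin
    suc (lo ℕ.+ x)     ≡⟨ ℕP.+-suc lo x ⟨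
    lo ℕ.+ suc x       ≤⟨ ℕP.+-monoʳ-≤ lo x<hi-lo ⟩
    lo ℕ.+ (hi ∸ lo)   ≡⟨ ℕP.m+[n∸m]≡n lo≤hi ⟩
    hi                 ∎)
  where
  open ℕP.≤-Reasoning
  x<hi-lo : x ℕ.< hi ∸ lo
  x<hi-lo = ∈-upTo⁻ x∈upTo
  lo≤hi : lo ℕ.≤ hi
  lo≤hi = ℕP.<⇒≤ (ℕP.m∸n≢0⇒n<m (ℕP.n>0⇒n≢0 (ℕP.≤-<-trans z≤n x<hi-lo)))

∈-range⁺ : ∀ {lo hi j} → lo ℕ.< j → j ℕ.≤ hi → j ∈ range lo hi
∈-range⁺ {lo} {hi} {j} lo<j j≤hi = subst (_∈ range lo hi) j≡ (∈-map⁺ _ (∈-upTo⁺ offset<))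
  where
  offset< : j ∸ suc lo ℕ.< hi ∸ lo
  offset< = subst (ℕ._≤ hi ∸ lo) (ℕP.+-∸-assoc 1 lo<j) (ℕP.∸-monoˡ-≤ lo j≤hi)
  j≡ : suc (lo ℕ.+ (j ∸ suc lo)) ≡ j
  j≡ = ℕP.m+[n∸m]≡n lo<j

length-range : ∀ lo hi → length (range lo hi) ≡ hi ∸ lo
length-range lo hi = trans (List.length-map _ (upTo (hi ∸ lo))) (List.length-upTo (hi ∸ lo))

allᵇ-true⇒ : ∀ {A : Set} (p : A → Bool) xs → allᵇ p xs ≡ true → ∀ {x} → x ∈ xs → p x ≡ true
allᵇ-true⇒ p (y ∷ ys) all-true x∈ with p y in py
allᵇ-true⇒ p (y ∷ ys) all-true (here refl) | true = py
allᵇ-true⇒ p (y ∷ ys) all-true (there x∈) | true = allᵇ-true⇒ p ys all-true x∈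

allᵇ-false⇒ : ∀ {A : Set} (p : A → Bool) xs → allᵇ p xs ≡ false → ∃ λ x → x ∈ xs × p x ≡ false
allᵇ-false⇒ p (y ∷ ys) all-false with p y in py
... | false = y , here refl , py
... | true with x , x∈ , px ← allᵇ-false⇒ p ys all-false = x , there x∈ , px

allᵇ-cong : ∀ {A : Set} (p q : A → Bool) xs → (∀ {x} → x ∈ xs → p x ≡ q x) → allᵇ p xs ≡ allᵇ q xs
allᵇ-cong p q []       p≡q = refl
allᵇ-cong p q (x ∷ xs) p≡q =
  cong₂ _∧_ (p≡q (here refl)) (allᵇ-cong p q xs (λ x∈ → p≡q (there x∈)))

k*0-vanishes : ∀ k → + 0 + k * + 0 ≡ + 0
k*0-vanishes k = trans (+-identityˡ (k * + 0)) (*-zeroʳ k)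

sum-shift : ∀ (f g : ℕ → ℤ) k xs → (∀ {x} → x ∈ xs → g x ≡ f x + k) →
  sumℤ (map g xs) ≡ sumℤ (map f xs) + k * + length xs
sum-shift f g k []       g≡f+k = sym (k*0-vanishes k)
sum-shift f g k (x ∷ xs) g≡f+k = begin
  g x + sumℤ (map g xs)
    ≡⟨ cong₂ _+_ (g≡f+k (here refl)) (sum-shift f g k xs (λ x∈ → g≡f+k (there x∈))) ⟩
  f x + k + (sumℤ (map f xs) + k * + length xs)
    ≡⟨ regroup (f x) k (sumℤ (map f xs)) (+ length xs) ⟩
  f x + sumℤ (map f xs) + k * (+ 1 + + length xs) ∎
  where
  open ≡-Reasoning
  regroup : ∀ a k s n → a + k + (s + k * n) ≡ a + s + k * (+ 1 + n)
  regroup = solve-∀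

T⇔⇒≡ : ∀ {b c} → (T b → T c) → (T c → T b) → b ≡ c
T⇔⇒≡ {false} {false} _ _ = refl
T⇔⇒≡ {false} {true}  _ c⇒b = ⊥-elim (c⇒b _)
T⇔⇒≡ {true}  {false} b⇒c _ = ⊥-elim (b⇒c _)
T⇔⇒≡ {true}  {true}  _ _ = refl

≤ᵇ-shift : ∀ x y k → ((x + k) ℤ.≤ᵇ (y + k)) ≡ (x ℤ.≤ᵇ y)
≤ᵇ-shift x y k = T⇔⇒≡
  (λ t → ≤⇒≤ᵇ (subst₂ _≤_ (cancel x k) (cancel y k) (+-monoˡ-≤ (- k) (≤ᵇ⇒≤ {x + k} {y + k} t))))
  (λ t → ≤⇒≤ᵇ (+-monoˡ-≤ k (≤ᵇ⇒≤ {x} {y} t)))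
  where
  cancel : ∀ x k → x + k + - k ≡ x
  cancel = solve-∀

InRange : ℕ → ℕ → ℕ → Set
InRange lo hi j = lo ℕ.< j × j ℕ.≤ hi

inRange? : ∀ lo hi j → Dec (InRange lo hi j)
inRange? lo hi j = lo ℕ.<? j ×-dec j ℕ.≤? hi

update : ℕ → ℕ → (ℕ → ℤ) → (ℕ → ℤ) → ℕ → ℤ
update lo hi new row j = if (lo ℕ.<ᵇ j) ∧ (j ℕ.≤ᵇ hi) then new j else row j

update-inside : ∀ {lo hi j} new row → InRange lo hi j → update lo hi new row j ≡ new j
update-inside {lo} {hi} {j} new row (lo<j , j≤hi)
  rewrite Equivalence.to T-≡ (ℕP.<⇒<ᵇ lo<j) | Equivalence.to T-≡ (ℕP.≤⇒≤ᵇ j≤hi) = refl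

update-outside : ∀ {lo hi j} new row → ¬ InRange lo hi j → update lo hi new row j ≡ row j
update-outside {lo} {hi} {j} new row outside with lo ℕ.<ᵇ j in lo<ᵇj | j ℕ.≤ᵇ hi in j≤ᵇhi
... | false | _     = refl
... | true  | false = refl
... | true  | true  = ⊥-elim (outside
  ( ℕP.<ᵇ⇒< lo j (Equivalence.from T-≡ lo<ᵇj)
  , ℕP.≤ᵇ⇒≤ j hi (Equivalence.from T-≡ j≤ᵇhi)))

-- What Fram computes for the block lo < j ≤ hi of a row i, given the row above
-- (prev, finite exactly for j ≤ μn = μ_{i+1}) and the running values a, b.
module Block (prev : ℕ → ℤ) (μn : ℕ) (a : ℤ) (b lo hi : ℕ) where

  -- The definitions below unfold exactly to the local definitions of processBlocks, so the
  -- step of processBlocks at block k′ reads: write entry on lo < j ≤ hi (via update), then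
  -- continue with a − Σ entry and b − (hi − lo).

  proposal : ℕ → ℤ
  proposal j = bcomp a b (j ∸ lo)

  fits : ℕ → Bool
  fits j = not (j ℕ.≤ᵇ μn) ∨ (proposal j ℤ.≤ᵇ (prev j - + 2))

  accepted : Bool
  accepted = allᵇ fits (range lo hi)

  entry : ℕ → ℤ
  entry j = if accepted then proposal j else prev j - + 2

  fits⇒≤ : ∀ j → j ℕ.≤ μn → fits j ≡ true → proposal j ≤ prev j - + 2
  fits⇒≤ j j≤μn fits-j rewrite Equivalence.to T-≡ (ℕP.≤⇒≤ᵇ j≤μn) =
    ≤ᵇ⇒≤ (Equivalence.from T-≡ fits-j)

  unfit⇒≤μn : ∀ j → fits j ≡ false → j ℕ.≤ μn
  unfit⇒≤μn j unfit with j ℕ.≤ᵇ μn in j≤ᵇμn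
  ... | true = ℕP.≤ᵇ⇒≤ j μn (Equivalence.from T-≡ j≤ᵇμn)

  unfit⇒> : ∀ j → fits j ≡ false → prev j - + 2 < proposal j
  unfit⇒> j unfit with j ℕ.≤ᵇ μn
  ... | true = ≰⇒> λ fit → subst T unfit (≤⇒≤ᵇ fit)

  rejected⇒unfit : accepted ≡ false → ∃ λ e → InRange lo hi e × fits e ≡ false
  rejected⇒unfit rejected with e , e∈ , unfit ← allᵇ-false⇒ fits (range lo hi) rejected =
    e , ∈-range⁻ e∈ , unfit

  entry-≤-above : ∀ j → j ℕ.≤ μn → InRange lo hi j → entry j ≤ prev j - + 2
  entry-≤-above j j≤μn (lo<j , j≤hi) with accepted in acc
  ... | false = ≤-refl
  ... | true  = fits⇒≤ j j≤μn (allᵇ-true⇒ fits (range lo hi) acc (∈-range⁺ lo<j j≤hi))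

-- Some entry of a nonempty block is at most ⌊a/b⌋: either the accepted first proposal,
-- or an entry t_{i+1,e} − 2 lying below a rejected proposal r_{i,e} ≤ ⌊a/b⌋ + 1.
module _ (prev : ℕ → ℤ) (μn : ℕ) (a : ℤ) (b₀ lo hi : ℕ) where
  open Block prev μn a (suc b₀) lo hi

  entry-≤-quotient : lo ℕ.< hi → ∃ λ e → InRange lo hi e × entry e ≤ a /ℕ suc b₀
  entry-≤-quotient lo<hi with accepted in acc
  ... | true = suc lo , (ℕP.≤-refl , lo<hi) ,
    ≤-reflexive (trans (cong (bcomp a (suc b₀)) (ℕP.m+n∸n≡m 1 lo)) (bcomp-first a b₀))
  ... | false with e , e∈ , unfit ← rejected⇒unfit acc = e , e∈ , <-suc⇒≤ (begin-strict
      prev e - + 2        <⟨ unfit⇒> e unfit ⟩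
      proposal e          ≤⟨ bcomp-≤ a b₀ (e ∸ lo) ⟩
      a /ℕ suc b₀ + + 1   ≡⟨ +-comm (a /ℕ suc b₀) (+ 1) ⟩
      + 1 + a /ℕ suc b₀  ∎)
    where open ≤-Reasoning

ShiftedOn : ℕ → (ℕ → ℤ) → (ℕ → ℤ) → ℤ → Set
ShiftedOn n f g k = ∀ j → 1 ℕ.≤ j → j ℕ.≤ n → g j ≡ f j + k

Aligned : ℕ → ℕ → ℕ → Set
Aligned μn lo hi = hi ℕ.≤ μn ⊎ μn ℕ.≤ lo

-- Translating the row above by k and the running sum a by k·b translates every entry of
-- an aligned block by k: Bcomp commutes with translation and the acceptance test is
-- translation invariant.
entry-shift : ∀ prev prev′ k μn a b lo hi → ShiftedOn μn prev prev′ k → Aligned μn lo hi →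
  hi ∸ lo ℕ.≤ b → ∀ j → InRange lo hi j →
  Block.entry prev′ μn (a + k * + b) b lo hi j ≡ Block.entry prev μn a b lo hi j + k
entry-shift prev prev′ k μn a b lo hi shifted aligned size≤b j (lo<j , j≤hi) =
  trans (cong (λ c → if c then B′.proposal j else prev′ j - + 2) accepted-shift)
        (by-acceptance B.accepted refl)
  where
  module B  = Block prev  μn a b lo hi
  module B′ = Block prev′ μn (a + k * + b) b lo hi
  open ≡-Reasoning

  1≤b : 1 ℕ.≤ b
  1≤b = ℕP.≤-trans (ℕP.m<n⇒0<n∸m (ℕP.<-≤-trans lo<j j≤hi)) size≤b

  minus-two : ∀ y k → y + k - + 2 ≡ y - + 2 + k
  minus-two = solve-∀

  proposal-shift : ∀ e → B′.proposal e ≡ B.proposal e + k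
  proposal-shift e = bcomp-shift a k b 1≤b (e ∸ lo)

  fits-shift : ∀ e → 1 ℕ.≤ e → B′.fits e ≡ B.fits e
  fits-shift e 1≤e with e ℕ.≤ᵇ μn in e≤ᵇμn
  ... | false = refl
  ... | true  = begin
    B′.proposal e ℤ.≤ᵇ (prev′ e - + 2)
      ≡⟨ cong₂ ℤ._≤ᵇ_ (proposal-shift e)
           (trans (cong (_- + 2) (shifted e 1≤e (ℕP.≤ᵇ⇒≤ e μn (Equivalence.from T-≡ e≤ᵇμn))))
                  (minus-two (prev e) k)) ⟩
    (B.proposal e + k) ℤ.≤ᵇ (prev e - + 2 + k)
      ≡⟨ ≤ᵇ-shift (B.proposal e) (prev e - + 2) k ⟩
    B.proposal e ℤ.≤ᵇ (prev e - + 2) ∎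

  accepted-shift : B′.accepted ≡ B.accepted
  accepted-shift = allᵇ-cong B′.fits B.fits (range lo hi)
    (λ e∈ → fits-shift _ (ℕP.<-≤-trans (s≤s z≤n) (proj₁ (∈-range⁻ e∈))))

  rejected⇒j≤μn : Aligned μn lo hi → B.accepted ≡ false → j ℕ.≤ μn
  rejected⇒j≤μn (inj₁ hi≤μn) _ = ℕP.≤-trans j≤hi hi≤μn
  rejected⇒j≤μn (inj₂ μn≤lo) rejected with e , (lo<e , _) , unfit ← B.rejected⇒unfit rejected =
    ⊥-elim (ℕP.<-irrefl refl (ℕP.≤-<-trans (B.unfit⇒≤μn e unfit) (ℕP.≤-<-trans μn≤lo lo<e)))

  by-acceptance : ∀ c → B.accepted ≡ c →
    (if c then B′.proposal j else prev′ j - + 2) ≡ (if c then B.proposal j else prev j - + 2) + k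
  by-acceptance true  _        = proposal-shift j
  by-acceptance false rejected =
    trans (cong (_- + 2) (shifted j (ℕP.<-≤-trans (s≤s z≤n) lo<j) (rejected⇒j≤μn aligned rejected)))
          (minus-two (prev j) k)

InBlock : List ℕ → ℕ → ℕ → Set
InBlock μ j k = InRange (part μ (suc k)) (part μ k) j

module _ (μ : List ℕ) (prev : ℕ → ℤ) (μn : ℕ) where

  processBlocks-untouched : ∀ j ks a b row → All (λ k → ¬ InBlock μ j k) ks →
    processBlocks μ prev μn a b ks row j ≡ row j
  processBlocks-untouched j []       a b row []            = refl
  processBlocks-untouched j (k ∷ ks) a b row (j∉k ∷ j∉ks) =
    trans (processBlocks-untouched j ks _ _ _ j∉ks)
          (update-outside (Block.entry prev μn a b (part μ (suc k)) (part μ k)) row j∉k)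

  processBlocks-invariant : ∀ j (Q : ℤ → Set) →
    (∀ a b k → InBlock μ j k → Q (Block.entry prev μn a b (part μ (suc k)) (part μ k) j)) →
    ∀ ks a b row → Q (row j) ⊎ Any (InBlock μ j) ks → Q (processBlocks μ prev μn a b ks row j)
  processBlocks-invariant j Q Q-entry []       a b row (inj₁ q) = q
  processBlocks-invariant j Q Q-entry (k ∷ ks) a b row q⊎j∈ks =
    processBlocks-invariant j Q Q-entry ks _ _ _ (after-block (inRange? lo hi j))
    where
    lo hi : ℕ
    lo = part μ (suc k)
    hi = part μ k
    entry : ℕ → ℤ
    entry = Block.entry prev μn a b lo hi
    after-block : Dec (InBlock μ j k) → Q (update lo hi entry row j) ⊎ Any (InBlock μ j) ks
    after-block (yes j∈k) = inj₁ (subst Q (sym (update-inside entry row j∈k)) (Q-entry a b k j∈k))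
    after-block (no  j∉k) =
      Sum.map (subst Q (sym (update-outside entry row j∉k))) (Any.tail j∉k) q⊎j∈ks

-- The blocks of ks, in the order processed, are aligned with μn and each fits into the
-- remaining length b; this is what makes the running sum translate correctly.
Valid : List ℕ → ℕ → ℕ → List ℕ → Set
Valid μ μn b []       = ⊤
Valid μ μn b (k ∷ ks) =
  (part μ k ∸ part μ (suc k) ℕ.≤ b) × Aligned μn (part μ (suc k)) (part μ k) ×
  Valid μ μn (b ∸ (part μ k ∸ part μ (suc k))) ks

running-sum-shift : ∀ a k b L S → L ℕ.≤ b →
  (a + k * + b) - (S + k * + L) ≡ (a - S) + k * + (b ∸ L)
running-sum-shift a k b L S L≤b = begin
  (a + k * + b) - (S + k * + L)   ≡⟨ regroup a k (+ b) S (+ L) ⟩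
  (a - S) + k * (+ b - + L)       ≡⟨ cong (λ x → (a - S) + k * x) b-L ⟩
  (a - S) + k * + (b ∸ L)         ∎
  where
  open ≡-Reasoning
  regroup : ∀ a k b S L → (a + k * b) - (S + k * L) ≡ (a - S) + k * (b - L)
  regroup = solve-∀
  b-L : + b - + L ≡ + (b ∸ L)
  b-L = trans (m-n≡m⊖n b L) (⊖-≥ L≤b)

processBlocks-shift : ∀ μ prev prev′ k μn → ShiftedOn μn prev prev′ k →
  ∀ j ks a b row row′ → Valid μ μn b ks → row′ j ≡ row j + k ⊎ Any (InBlock μ j) ks →
  processBlocks μ prev′ μn (a + k * + b) b ks row′ j ≡ processBlocks μ prev μn a b ks row j + k
processBlocks-shift μ prev prev′ k μn shifted j []        a b row row′ _ (inj₁ row-shift) = row-shift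
processBlocks-shift μ prev prev′ k μn shifted j (kk ∷ ks) a b row row′ (L≤b , aligned , valid) h =
  begin
    processBlocks μ prev′ μn ((a + k * + b) - S′) (b ∸ L) ks (update lo hi entry′ row′) j
      ≡⟨ cong (λ a′ → processBlocks μ prev′ μn a′ (b ∸ L) ks (update lo hi entry′ row′) j) sum-step ⟩
    processBlocks μ prev′ μn ((a - S) + k * + (b ∸ L)) (b ∸ L) ks (update lo hi entry′ row′) j
      ≡⟨ processBlocks-shift μ prev prev′ k μn shifted j ks (a - S) (b ∸ L)
           (update lo hi entry row) (update lo hi entry′ row′) valid (after-block (inRange? lo hi j)) ⟩
    processBlocks μ prev μn (a - S) (b ∸ L) ks (update lo hi entry row) j + k
      ∎
  where
  open ≡-Reasoning
  lo hi L : ℕ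
  lo = part μ (suc kk)
  hi = part μ kk
  L  = hi ∸ lo
  entry entry′ : ℕ → ℤ
  entry  = Block.entry prev  μn a b lo hi
  entry′ = Block.entry prev′ μn (a + k * + b) b lo hi
  entries-shift : ∀ {e} → InRange lo hi e → entry′ e ≡ entry e + k
  entries-shift {e} = entry-shift prev prev′ k μn a b lo hi shifted aligned L≤b e
  S S′ : ℤ
  S  = sumℤ (map entry  (range lo hi))
  S′ = sumℤ (map entry′ (range lo hi))
  sum-step : (a + k * + b) - S′ ≡ (a - S) + k * + (b ∸ L)
  sum-step = begin
    (a + k * + b) - S′
      ≡⟨ cong (λ x → (a + k * + b) - x)
           (sum-shift entry entry′ k (range lo hi) (entries-shift ∘ ∈-range⁻)) ⟩
    (a + k * + b) - (S + k * + length (range lo hi))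
      ≡⟨ cong (λ n → (a + k * + b) - (S + k * + n)) (length-range lo hi) ⟩
    (a + k * + b) - (S + k * + L)
      ≡⟨ running-sum-shift a k b L S L≤b ⟩
    (a - S) + k * + (b ∸ L) ∎
  after-block : Dec (InBlock μ j kk) →
    update lo hi entry′ row′ j ≡ update lo hi entry row j + k ⊎ Any (InBlock μ j) ks
  after-block (yes j∈kk) = inj₁ (begin
    update lo hi entry′ row′ j ≡⟨ update-inside entry′ row′ j∈kk ⟩
    entry′ j                   ≡⟨ entries-shift j∈kk ⟩
    entry j + k                ≡⟨ cong (_+ k) (update-inside entry row j∈kk) ⟨
    update lo hi entry row j + k ∎)
  after-block (no j∉kk) = Sum.map
    (λ row-shift → trans (update-outside entry′ row′ j∉kk)
                     (trans row-shift (cong (_+ k) (sym (update-outside entry row j∉kk)))))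
    (Any.tail j∉kk) h

processBlocks-≤-above : ∀ μ prev μn j → j ℕ.≤ μn → ∀ ks a b row → Any (InBlock μ j) ks →
  processBlocks μ prev μn a b ks row j ≤ prev j - + 2
processBlocks-≤-above μ prev μn j j≤μn ks a b row j∈ks =
  processBlocks-invariant μ prev μn j (_≤ prev j - + 2)
    (λ a b k j∈k → Block.entry-≤-above prev μn a b (part μ (suc k)) (part μ k) j j≤μn j∈k)
    ks a b row (inj₂ j∈ks)

processBlocks-first-block : ∀ μ prev μn a b kk ks row → 1 ℕ.≤ b →
  part μ (suc kk) ℕ.< part μ kk → (∀ e → InBlock μ e kk → All (λ k → ¬ InBlock μ e k) ks) →
  ∃ λ e → InBlock μ e kk × + b * processBlocks μ prev μn a b (kk ∷ ks) row e ≤ a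
processBlocks-first-block μ prev μn a (suc b₀) kk ks row _ nonempty later-miss
  with e , e∈kk , small ← entry-≤-quotient prev μn a b₀ (part μ (suc kk)) (part μ kk) nonempty =
  e , e∈kk , ≤-quotient⇒*≤ a b₀ _ (subst (_≤ _) (sym final-value) small)
  where
  entry : ℕ → ℤ
  entry = Block.entry prev μn a (suc b₀) (part μ (suc kk)) (part μ kk)
  final-value : processBlocks μ prev μn a (suc b₀) (kk ∷ ks) row e ≡ entry e
  final-value = trans (processBlocks-untouched μ prev μn e ks _ _ _ (later-miss e e∈kk))
                      (update-inside entry row e∈kk)

part-beyond : ∀ μ n → length μ ℕ.< n → part μ n ≡ 0
part-beyond []       n             _         = refl
part-beyond (x ∷ xs) (suc (suc n)) (s≤s r<n) = part-beyond xs (suc n) r<n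

countdown : ℕ → ℕ → List ℕ
countdown m zero    = m ∷ []
countdown m (suc n) = m ∷ countdown (ℕ.pred m) n

downTo≡countdown : ∀ r i → downTo r i ≡ countdown r (r ∸ i)
downTo≡countdown r i = trans (List.map-upTo (r ∸_) (suc (r ∸ i))) (go (r ∸_) r (r ∸ i) (λ _ → refl))
  where
  pred-∸ : ∀ m x → m ∸ suc x ≡ ℕ.pred m ∸ x
  pred-∸ zero    x = sym (ℕP.0∸n≡0 x)
  pred-∸ (suc m) x = refl
  go : ∀ (f : ℕ → ℕ) m n → (∀ x → f x ≡ m ∸ x) → applyUpTo f (suc n) ≡ countdown m n
  go f m zero    f≡ = cong (_∷ []) (f≡ 0)
  go f m (suc n) f≡ = cong₂ _∷_ (f≡ 0)
    (go (λ x → f (suc x)) (ℕ.pred m) n (λ x → trans (f≡ (suc x)) (pred-∸ m x)))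

countdown-covers : ∀ μ n m j → part μ (suc m) ℕ.< j → j ℕ.≤ part μ (m ∸ n) → n ℕ.≤ m →
  Any (InBlock μ j) (countdown m n)
countdown-covers μ zero    m       j above below _       = here (above , below)
countdown-covers μ (suc n) (suc m) j above below (s≤s n≤m) with j ℕ.≤? part μ (suc m)
... | yes j≤μm = here (above , j≤μm)
... | no  j≰μm = there (countdown-covers μ n m j (ℕP.≰⇒> j≰μm) below n≤m)

module Partition (μ : List ℕ) (isP : IsPartition μ) where

  r : ℕ
  r = length μ

  -- μ_{n+1} ≤ μ_n also for the last row, where μ_{r+1} = 0.
  part-step : ∀ n → 1 ℕ.≤ n → part μ (suc n) ℕ.≤ part μ n
  part-step n 1≤n with n ℕ.<? r
  ... | yes n<r = proj₂ isP n 1≤n n<r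
  ... | no  n≮r = subst (ℕ._≤ part μ n) (sym (part-beyond μ (suc n) (s≤s (ℕP.≮⇒≥ n≮r)))) z≤n

  part-antitone : ∀ i m → 1 ℕ.≤ i → i ℕ.≤ m → part μ m ℕ.≤ part μ i
  part-antitone i zero    1≤i i≤0 = ⊥-elim (ℕP.<-irrefl refl (ℕP.≤-trans 1≤i i≤0))
  part-antitone i (suc m) 1≤i i≤m+1 with ℕP.m≤n⇒m<n∨m≡n i≤m+1
  ... | inj₂ refl       = ℕP.≤-refl
  ... | inj₁ (s≤s i≤m) = ℕP.≤-trans (part-step m (ℕP.≤-trans 1≤i i≤m)) (part-antitone i m 1≤i i≤m)

  countdown-misses : ∀ n m j → j ℕ.≤ part μ (suc m) → All (λ k → ¬ InBlock μ j k) (countdown m n)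
  countdown-misses zero    m j j≤ = (λ (above , _) → ℕP.<-irrefl refl (ℕP.<-≤-trans above j≤)) ∷ []
  countdown-misses (suc n) m j j≤ = (λ (above , _) → ℕP.<-irrefl refl (ℕP.<-≤-trans above j≤)) ∷
    countdown-misses n (ℕ.pred m) j
      (ℕP.≤-trans j≤ (part-antitone (suc (ℕ.pred m)) (suc m) (s≤s z≤n) (s≤s ℕP.pred[n]≤n)))

  countdown-valid : ∀ i n m → 1 ℕ.≤ i → i ℕ.+ n ≡ m →
    Valid μ (part μ (suc i)) (part μ i ∸ part μ (suc m)) (countdown m n)
  countdown-valid i zero m 1≤i i+0≡m rewrite sym i+0≡m | ℕP.+-identityʳ i =
    ℕP.≤-refl , inj₂ ℕP.≤-refl , tt
  countdown-valid i (suc n) zero 1≤i i+n+1≡0 = ⊥-elim (ℕP.m+1+n≢0 i i+n+1≡0)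
  countdown-valid i (suc n) (suc m) 1≤i i+n+1≡m+1 =
    ℕP.∸-monoˡ-≤ (part μ (suc (suc m))) (part-antitone i (suc m) 1≤i i≤m+1) ,
    inj₁ (part-antitone (suc i) (suc m) (s≤s z≤n) (s≤s i≤m)) ,
    subst (λ b → Valid μ (part μ (suc i)) b (countdown m n))
      (sym (∸-telescope (part μ i) (part μ (suc m)) (part μ (suc (suc m))) (part-step (suc m) (s≤s z≤n))))
      (countdown-valid i n m 1≤i i+n≡m)
    where
    i+n≡m : i ℕ.+ n ≡ m
    i+n≡m = ℕP.suc-injective (trans (sym (ℕP.+-suc i n)) i+n+1≡m+1)
    i≤m : i ℕ.≤ m
    i≤m = subst (i ℕ.≤_) i+n≡m (ℕP.m≤m+n i n)
    i≤m+1 : i ℕ.≤ suc m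
    i≤m+1 = ℕP.m≤n⇒m≤1+n i≤m
    ∸-telescope : ∀ x y z → z ℕ.≤ y → x ∸ z ∸ (y ∸ z) ≡ x ∸ y
    ∸-telescope x y z z≤y = trans (ℕP.∸-+-assoc x z (y ∸ z)) (cong (x ∸_) (ℕP.m+[n∸m]≡n z≤y))

module Framed (μ : List ℕ) (isP : IsPartition μ) where
  open Partition μ isP

  μr-pos : 1 ℕ.≤ r → 1 ℕ.≤ part μ r
  μr-pos 1≤r = proj₁ isP r 1≤r ℕP.≤-refl

  r-i≡ : ∀ i → i ℕ.< r → r ∸ i ≡ suc (r ∸ suc i)
  r-i≡ i i<r = ℕP.+-∸-assoc 1 i<r

  innerLoop : ℕ → (ℕ → ℤ) → ℤ → List ℕ → ℕ → ℤ
  innerLoop i prev a ks = processBlocks μ prev (part μ (suc i)) a (part μ i) ks (λ _ → + 0)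

  Fram-top : ∀ s j → Fram μ s r j ≡ bcomp (sv s r) (part μ r) j
  Fram-top s j rewrite ℕP.n∸n≡0 r = refl

  Fram-step : ∀ s i → i ℕ.< r → ∀ j → Fram μ s i j ≡ innerLoop i (Fram μ s (suc i)) (sv s i) (downTo r i) j
  Fram-step s i i<r j = begin
    framRow μ s (r ∸ i) j
      ≡⟨ cong (λ d → framRow μ s d j) (r-i≡ i i<r) ⟩
    framRow μ s (suc (r ∸ suc i)) j
      ≡⟨ cong (λ i′ → innerLoop i′ (Fram μ s (suc i)) (sv s i′) (downTo r i′) j) i′≡i ⟩
    innerLoop i (Fram μ s (suc i)) (sv s i) (downTo r i) j ∎
    where
    open ≡-Reasoning
    i′≡i : r ∸ suc (r ∸ suc i) ≡ i
    i′≡i = trans (cong (r ∸_) (sym (r-i≡ i i<r))) (ℕP.m∸[m∸n]≡n (ℕP.<⇒≤ i<r))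

  row-covered : ∀ i j → i ℕ.≤ r → 1 ℕ.≤ j → j ℕ.≤ part μ i → Any (InBlock μ j) (downTo r i)
  row-covered i j i≤r 1≤j j≤μi = subst (Any (InBlock μ j)) (sym (downTo≡countdown r i))
    (countdown-covers μ (r ∸ i) r j
      (subst (ℕ._< j) (sym (part-beyond μ (suc r) ℕP.≤-refl)) 1≤j)
      (subst (λ i′ → j ℕ.≤ part μ i′) (sym (ℕP.m∸[m∸n]≡n i≤r)) j≤μi)
      (ℕP.m∸n≤m r i))

  row-valid : ∀ i → 1 ℕ.≤ i → i ℕ.≤ r → Valid μ (part μ (suc i)) (part μ i) (downTo r i)
  row-valid i 1≤i i≤r = subst₂ (Valid μ (part μ (suc i)))
    (cong (part μ i ∸_) (part-beyond μ (suc r) ℕP.≤-refl))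
    (sym (downTo≡countdown r i))
    (countdown-valid i (r ∸ i) r 1≤i (ℕP.m+[n∸m]≡n i≤r))

  Fram-shift : ∀ s s′ k → (∀ i → sv s′ i ≡ sv s i + k * + part μ i) →
    ∀ i j → InD μ i j → Fram μ s′ i j ≡ Fram μ s i j + k
  Fram-shift s s′ k s′≡ i j (1≤i , i≤r , 1≤j , j≤μi) =
    from-top (r ∸ i) i (ℕP.m+[n∸m]≡n i≤r) 1≤i j 1≤j j≤μi
    where
    from-top : ∀ d i → i ℕ.+ d ≡ r → 1 ℕ.≤ i → ShiftedOn (part μ i) (Fram μ s i) (Fram μ s′ i) k
    from-top zero i i+0≡r 1≤i j 1≤j j≤μi =
      subst (λ i → Fram μ s′ i j ≡ Fram μ s i j + k) (sym i≡r) (begin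
        Fram μ s′ r j                                ≡⟨ Fram-top s′ j ⟩
        bcomp (sv s′ r) (part μ r) j                 ≡⟨ cong (λ c → bcomp c (part μ r) j) (s′≡ r) ⟩
        bcomp (sv s r + k * + part μ r) (part μ r) j ≡⟨ bcomp-shift (sv s r) k (part μ r) (μr-pos 1≤r) j ⟩
        bcomp (sv s r) (part μ r) j + k              ≡⟨ cong (_+ k) (Fram-top s j) ⟨
        Fram μ s r j + k                             ∎)
      where
      open ≡-Reasoning
      i≡r : i ≡ r
      i≡r = trans (sym (ℕP.+-identityʳ i)) i+0≡r
      1≤r : 1 ℕ.≤ r
      1≤r = subst (1 ℕ.≤_) i≡r 1≤i
    from-top (suc d) i i+d+1≡r 1≤i j 1≤j j≤μi = begin
      Fram μ s′ i j
        ≡⟨ Fram-step s′ i i<r j ⟩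
      innerLoop i (Fram μ s′ (suc i)) (sv s′ i) (downTo r i) j
        ≡⟨ cong (λ a → innerLoop i (Fram μ s′ (suc i)) a (downTo r i) j) (s′≡ i) ⟩
      innerLoop i (Fram μ s′ (suc i)) (sv s i + k * + part μ i) (downTo r i) j
        ≡⟨ processBlocks-shift μ (Fram μ s (suc i)) (Fram μ s′ (suc i)) k (part μ (suc i)) row-above
             j (downTo r i) (sv s i) (part μ i) (λ _ → + 0) (λ _ → + 0)
             (row-valid i 1≤i (ℕP.<⇒≤ i<r)) (inj₂ (row-covered i j (ℕP.<⇒≤ i<r) 1≤j j≤μi)) ⟩
      innerLoop i (Fram μ s (suc i)) (sv s i) (downTo r i) j + k
        ≡⟨ cong (_+ k) (Fram-step s i i<r j) ⟨
      Fram μ s i j + k ∎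
      where
      open ≡-Reasoning
      i<r : i ℕ.< r
      i<r = subst (i ℕ.<_) i+d+1≡r
              (subst (ℕ._≤ i ℕ.+ suc d) (ℕP.+-comm i 1) (ℕP.+-monoʳ-≤ i (s≤s z≤n)))
      row-above : ShiftedOn (part μ (suc i)) (Fram μ s (suc i)) (Fram μ s′ (suc i)) k
      row-above = from-top d (suc i) (trans (sym (ℕP.+-suc i d)) i+d+1≡r) (s≤s z≤n)

  Fram-column : ∀ s i j → 1 ℕ.≤ i → i ℕ.< r → 1 ℕ.≤ j → j ℕ.≤ part μ (suc i) →
    Fram μ s i j ≤ Fram μ s (suc i) j - + 2
  Fram-column s i j 1≤i i<r 1≤j j≤μi+1 =
    subst (_≤ Fram μ s (suc i) j - + 2) (sym (Fram-step s i i<r j))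
      (processBlocks-≤-above μ (Fram μ s (suc i)) (part μ (suc i)) j j≤μi+1
        (downTo r i) (sv s i) (part μ i) (λ _ → + 0)
        (row-covered i j (ℕP.<⇒≤ i<r) 1≤j (ℕP.≤-trans j≤μi+1 (part-step i 1≤i))))

  Fram-column-growth : ∀ s i j → suc i ℕ.≤ r → 1 ℕ.≤ j → j ℕ.≤ part μ (suc i) →
    Fram μ s 1 j + + 2 * + i ≤ Fram μ s (suc i) j
  Fram-column-growth s zero j _ _ _ = ≤-reflexive (+-identityʳ (Fram μ s 1 j))
  Fram-column-growth s (suc i) j i+2≤r 1≤j j≤μi+2 = begin
    Fram μ s 1 j + + 2 * + suc i
      ≡⟨ regroup (Fram μ s 1 j) (+ i) ⟩
    Fram μ s 1 j + + 2 * + i + + 2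
      ≤⟨ +-monoˡ-≤ (+ 2) (Fram-column-growth s i j (ℕP.<⇒≤ i+2≤r) 1≤j j≤μi+1) ⟩
    Fram μ s (suc i) j + + 2
      ≤⟨ +-monoˡ-≤ (+ 2) (Fram-column s (suc i) j (s≤s z≤n) i+2≤r 1≤j j≤μi+2) ⟩
    Fram μ s (suc (suc i)) j - + 2 + + 2
      ≡⟨ minus-plus (Fram μ s (suc (suc i)) j) ⟩
    Fram μ s (suc (suc i)) j ∎
    where
    open ≤-Reasoning
    j≤μi+1 : j ℕ.≤ part μ (suc i)
    j≤μi+1 = ℕP.≤-trans j≤μi+2 (part-step (suc i) (s≤s z≤n))
    regroup : ∀ t i → t + + 2 * (+ 1 + i) ≡ t + + 2 * i + + 2
    regroup = solve-∀
    minus-plus : ∀ t → t - + 2 + + 2 ≡ t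
    minus-plus = solve-∀

  -- Some entry of row i among the first μ_r columns is at most s_i / μ_i: it comes from the
  -- first block k′ = r, whose proposals are Bcomp(s_i, μ_i).
  Fram-row-bound : ∀ s i → 1 ℕ.≤ i → i ℕ.≤ r →
    ∃ λ e → 1 ℕ.≤ e × e ℕ.≤ part μ r × + part μ i * Fram μ s i e ≤ sv s i
  Fram-row-bound s i 1≤i i≤r with ℕP.m≤n⇒m<n∨m≡n i≤r
  ... | inj₂ refl = 1 , ℕP.≤-refl , μr-pos 1≤i ,
    subst (λ x → + part μ r * x ≤ sv s r) (sym (Fram-top s 1))
      (bcomp-first-bound (sv s r) (part μ r) (μr-pos 1≤i))
  ... | inj₁ i<r = conclude (processBlocks-first-block μ (Fram μ s (suc i)) (part μ (suc i))
                     (sv s i) (part μ i) r rest (λ _ → + 0) (proj₁ isP i 1≤i i≤r) nonempty later-miss)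
    where
    rest : List ℕ
    rest = countdown (ℕ.pred r) (r ∸ suc i)
    blocks≡ : downTo r i ≡ r ∷ rest
    blocks≡ = trans (downTo≡countdown r i) (cong (countdown r) (r-i≡ i i<r))
    μr+1≡0 : part μ (suc r) ≡ 0
    μr+1≡0 = part-beyond μ (suc r) ℕP.≤-refl
    nonempty : part μ (suc r) ℕ.< part μ r
    nonempty = subst (ℕ._< part μ r) (sym μr+1≡0) (μr-pos (ℕP.≤-trans (s≤s z≤n) i<r))
    later-miss : ∀ e → InBlock μ e r → All (λ k → ¬ InBlock μ e k) rest
    later-miss e (_ , e≤μr) = countdown-misses (r ∸ suc i) (ℕ.pred r) e
      (subst (λ m → e ℕ.≤ part μ m) (sym (ℕP.suc-pred r {{ℕ.>-nonZero (ℕP.≤-<-trans z≤n i<r)}})) e≤μr)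
    row-i≡ : ∀ e → Fram μ s i e ≡ innerLoop i (Fram μ s (suc i)) (sv s i) (r ∷ rest) e
    row-i≡ e = trans (Fram-step s i i<r e)
                     (cong (λ ks → innerLoop i (Fram μ s (suc i)) (sv s i) ks e) blocks≡)
    conclude : (∃ λ e → InBlock μ e r ×
                 + part μ i * innerLoop i (Fram μ s (suc i)) (sv s i) (r ∷ rest) e ≤ sv s i) →
               ∃ λ e → 1 ℕ.≤ e × e ℕ.≤ part μ r × + part μ i * Fram μ s i e ≤ sv s i
    conclude (e , (above , e≤μr) , bound) =
      e , subst (ℕ._< e) μr+1≡0 above , e≤μr ,
      subst (λ x → + part μ i * x ≤ sv s i) (sym (row-i≡ e)) bound

  -- The small entry e of row i given by Fram-row-bound sits
  -- in a column whose entries grow by 2 per row from a positive bottom entry.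
  framing-lower-shift : ∀ s k → (∀ i j → InD μ i j → + 0 < Fram μ s i j + k) →
    ∀ i → 1 ℕ.≤ i → i ℕ.≤ r → + ((2 ℕ.* i ∸ 1) ℕ.* part μ i) ≤ sv s i + k * + part μ i
  framing-lower-shift s k positive (suc i) 1≤i i≤r
    with e , 1≤e , e≤μr , bound ← Fram-row-bound s (suc i) 1≤i i≤r = begin
    + ((2 ℕ.* suc i ∸ 1) ℕ.* m)          ≡⟨ cong (λ x → + (x ℕ.* m)) (cong (_∸ 1) (ℕP.*-suc 2 i)) ⟩
    + (suc (2 ℕ.* i) ℕ.* m)              ≡⟨ pos-* (suc (2 ℕ.* i)) m ⟩
    (+ 1 + + (2 ℕ.* i)) * + m            ≡⟨ cong (λ x → (+ 1 + x) * + m) (pos-* 2 i) ⟩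
    (+ 1 + + 2 * + i) * + m              ≤⟨ *-monoʳ-≤-nonNeg (+ m) lower-entry ⟩
    (Fram μ s (suc i) e + k) * + m       ≡⟨ distrib (Fram μ s (suc i) e) k (+ m) ⟩
    + m * Fram μ s (suc i) e + k * + m   ≤⟨ +-monoˡ-≤ (k * + m) bound ⟩
    sv s (suc i) + k * + m               ∎
    where
    open ≤-Reasoning
    m : ℕ
    m = part μ (suc i)
    distrib : ∀ t k m → (t + k) * m ≡ m * t + k * m
    distrib = solve-∀
    e≤μi : e ℕ.≤ m
    e≤μi = ℕP.≤-trans e≤μr (part-antitone (suc i) r 1≤i i≤r)
    bottom-positive : + 1 ≤ Fram μ s 1 e + k
    bottom-positive = i<j⇒suc[i]≤j (positive 1 e (ℕP.≤-refl , ℕP.≤-trans 1≤i i≤r , 1≤e ,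
                                    ℕP.≤-trans e≤μi (part-antitone 1 (suc i) ℕP.≤-refl 1≤i)))
    lower-entry : + 1 + + 2 * + i ≤ Fram μ s (suc i) e + k
    lower-entry = begin
      + 1 + + 2 * + i                 ≤⟨ +-monoˡ-≤ (+ 2 * + i) bottom-positive ⟩
      Fram μ s 1 e + k + + 2 * + i    ≡⟨ swap (Fram μ s 1 e) k (+ 2 * + i) ⟩
      Fram μ s 1 e + + 2 * + i + k    ≤⟨ +-monoˡ-≤ k (Fram-column-growth s i e i≤r 1≤e e≤μi) ⟩
      Fram μ s (suc i) e + k          ∎
      where
      swap : ∀ a b c → a + b + c ≡ a + c + b
      swap = solve-∀

  framing-equal-shift : ∀ s k i → part μ (suc i) ≡ part μ i →
    sv s i + + (2 ℕ.* part μ i) ≤ sv s (suc i) →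
    (sv s i + k * + part μ i) + + (2 ℕ.* part μ i) ≤ sv s (suc i) + k * + part μ (suc i)
  framing-equal-shift s k i μi+1≡μi gap = begin
    (sv s i + k * + part μ i) + + (2 ℕ.* part μ i)  ≡⟨ swap (sv s i) (k * + part μ i) (+ (2 ℕ.* part μ i)) ⟩
    (sv s i + + (2 ℕ.* part μ i)) + k * + part μ i  ≤⟨ +-monoˡ-≤ (k * + part μ i) gap ⟩
    sv s (suc i) + k * + part μ i                    ≡⟨ cong (λ x → sv s (suc i) + k * + x) μi+1≡μi ⟨
    sv s (suc i) + k * + part μ (suc i)              ∎
    where
    open ≤-Reasoning
    swap : ∀ a b c → a + b + c ≡ a + c + b
    swap = solve-∀

  -- The framing condition passes to the translate s′_i = s_i + k·μ_i, provided the
  -- translated entries stay positive (the lower bounds then follow from positivity alone).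
  framing-shift : ∀ s s′ k → (∀ i → sv s′ i ≡ sv s i + k * + part μ i) →
    (∀ i j → InD μ i j → + 0 < Fram μ s i j + k) → FramingCondition μ s → FramingCondition μ s′
  framing-shift s s′ k s′≡ positive (_ , equal) =
    (λ i 1≤i i≤r → subst (_ ≤_) (sym (s′≡ i)) (framing-lower-shift s k positive i 1≤i i≤r)) ,
    (λ i 1≤i i<r μ≡ → subst₂ (λ a b → a + _ ≤ b) (sym (s′≡ i)) (sym (s′≡ (suc i)))
                        (framing-equal-shift s k i μ≡ (equal i 1≤i i<r μ≡)))

translateSums : ℤ → List ℤ → List ℕ → List ℤ
translateSums k = zipWith (λ x m → x + k * + m)

-- the i-th translated sum is s_i + k·μ_i (both are 0 + k·0 outside 1..r)
sv-translateSums : ∀ k s μ → length s ≡ length μ →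
  ∀ i → sv (translateSums k s μ) i ≡ sv s i + k * + part μ i
sv-translateSums k []       []       _     i             = sym (k*0-vanishes k)
sv-translateSums k (x ∷ xs) (m ∷ ms) _     zero          = sym (k*0-vanishes k)
sv-translateSums k (x ∷ xs) (m ∷ ms) _     (suc zero)    = refl
sv-translateSums k (x ∷ xs) (m ∷ ms) |s|≡ (suc (suc i)) =
  sv-translateSums k xs ms (ℕP.suc-injective |s|≡) (suc i)

length-translateSums : ∀ k s μ → length s ≡ length μ → length (translateSums k s μ) ≡ length μ
length-translateSums k s μ |s|≡ =
  trans (List.length-zipWith _ s μ) (trans (cong (ℕ._⊓ length μ) |s|≡) (ℕP.⊓-idem (length μ)))

mainTheorem9 : (μ : List ℕ) (T : Tab) (k : ℤ) →
    IsFramedTableau μ T →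
    ((i j : ℕ) → InD μ i j → + 0 < shift T k i j) →
    IsFramedTableau μ (shift T k)
mainTheorem9 μ T k (isP , _ , s , |s|≡ , framing , T≡Fram) T+k-positive =
  isP , T+k-positive , s′ , length-translateSums k s μ |s|≡ ,
  framing-shift s s′ k s′≡ Fram+k-positive framing , T+k≡Fram′
  where
  open Framed μ isP
  s′ : List ℤ
  s′ = translateSums k s μ
  s′≡ : ∀ i → sv s′ i ≡ sv s i + k * + part μ i
  s′≡ = sv-translateSums k s μ |s|≡
  Fram+k-positive : ∀ i j → InD μ i j → + 0 < Fram μ s i j + k
  Fram+k-positive i j ij∈D = subst (λ t → + 0 < t + k) (T≡Fram i j ij∈D) (T+k-positive i j ij∈D)
  T+k≡Fram′ : ∀ i j → InD μ i j → shift T k i j ≡ Fram μ s′ i j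
  T+k≡Fram′ i j ij∈D = trans (cong (_+ k) (T≡Fram i j ij∈D)) (sym (Fram-shift s s′ k s′≡ i j ij∈D))
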